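{- Every graph $H$ is the $\gamma_{ID}$-graph of some graph; that is, for every graph $H$ there exists a graph $G$ with $G(\gamma_{ID})\cong H$.
   Context: For a graph $G$, a set $S\subseteq V(G)$ is an identifying code if for every $v\in V(G)$ the set $N[v]\cap S$ is nonempty and these sets are pairwise distinct over all vertices $v$. $\gamma_{ID}(G)$ is the minimum cardinality of an identifying code, and a $\gamma_{ID}$-set is an identifying code of that cardinality. The $\gamma_{ID}$-graph $G(\gamma_{ID})$ has one vertex for each $\gamma_{ID}$-set of $G$, and the vertices corresponding to $S_u,S_w$ are adjacent iff there exist $u'\in S_u$, $w'\in S_w$ with $u'w'\in E(G)$ and $S_w=(S_u-\{u'\})\cup\{w'\}$. -}

module Defs where

open import Data.Nat using (ℕ; _≤_)
open import Data.Bool using (Bool; true; false; _∨_)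
open import Data.Fin using (Fin)
open import Data.Fin.Subset using (Subset; _∈_; _∩_; _∪_; _-_; ⁅_⁆; ∣_∣; Nonempty)
open import Data.Vec using (tabulate)
open import Data.Product using (Σ; _×_; ∃)
open import Relation.Binary.PropositionalEquality using (_≡_; _≢_)
open import Relation.Nullary using (Dec; does)
import Data.Fin as F

record Graph (n : ℕ) : Set where
  field
    adj    : Fin n → Fin n → Bool
    sym    : ∀ i j → adj i j ≡ adj j i
    irrefl : ∀ i → adj i i ≡ false

open Graph public

Edge : ∀ {n} → Graph n → Fin n → Fin n → Set
Edge G u v = adj G u v ≡ true

N[_]_ : ∀ {n} → Graph n → Fin n → Subset n
N[ G ] v = tabulate (λ u → does (u F.≟ v) ∨ adj G v u)

IsIDCode : ∀ {n} → Graph n → Subset n → Set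
IsIDCode G S =
  (∀ v → Nonempty ((N[ G ] v) ∩ S)) ×
  (∀ u v → u ≢ v → (N[ G ] u) ∩ S ≢ (N[ G ] v) ∩ S)

IsγIDSet : ∀ {n} → Graph n → Subset n → Set
IsγIDSet G S = IsIDCode G S × (∀ T → IsIDCode G T → ∣ S ∣ ≤ ∣ T ∣)

γIDAdj : ∀ {n} → Graph n → Subset n → Subset n → Set
γIDAdj G S T =
  Σ _ λ u′ → Σ _ λ w′ →
    u′ ∈ S × w′ ∈ T × Edge G u′ w′ × (T ≡ (S - u′) ∪ ⁅ w′ ⁆)

γIDGraph≅ : ∀ {m k} → Graph m → Graph k → Set
γIDGraph≅ {m} {k} G H =
  Σ (Fin k → Subset m) λ f →
    (∀ i j → f i ≡ f j → i ≡ j) ×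
    (∀ i → IsγIDSet G (f i)) ×
    (∀ S → IsγIDSet G S → ∃ λ i → f i ≡ S) ×
    (∀ i j → (Edge H i j → γIDAdj G (f i) (f j)) × (γIDAdj G (f i) (f j) → Edge H i j))

module Submission where

-- Let H have vertex set Fin k and let H⁺ be the cone over H,
-- i.e. H with an extra vertex 0 adjacent to all others.  G consists of one
-- copy of a seven-vertex gadget for every vertex of H⁺, plus a vertex w.  In
-- the gadget the apex 0 is adjacent to every other vertex, 1 to 3 and 4, and
-- 2 to 5 and 6; the apices of two copies are adjacent iff the corresponding
-- vertices of H⁺ are, and w is adjacent to the whole copy 0.
--
-- Each leaf 3, 4, 5, 6 of a copy is the only vertex distinguishing
-- two twins of that copy (e.g. 1 and 4 for the leaf 3), so every identifying
-- code contains the set L of all leaves; separating w from the apex of copy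
-- 0 forces moreover the apex x_j of some copy j ≥ 1.  Conversely every
-- S_j = L ∪ {x_j} is an identifying code.  Hence the γ_ID-sets of G are
-- exactly the S_j (general lemmas cover-γID-sets, cover-exhausts), and j ↦ S_j is an
-- isomorphism because S_i, S_j are adjacent in the γ_ID-graph iff x_i x_j is
-- an edge of G (general lemmas edge⇒exchange, exchange⇒edge), i.e. iff ij
-- is an edge of H.

open import Defs
open import Data.Nat using (ℕ; suc; _≤_; _*_)
open import Data.Nat.Properties using (≤-pred; n≮n; ≤-trans)
open import Data.Bool using (Bool; true; false; _∨_; _∧_; not; if_then_else_)
open import Data.Bool.Properties using (∨-identityʳ; ∧-identityʳ; ∧-zeroʳ; ∨-conicalˡ; ∨-conicalʳ)
import Data.Bool.Properties as Bool
open import Data.Fin using (Fin; zero; suc; _≟_; combine; remQuot)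
open import Data.Fin.Subset using (Subset; Nonempty; _∈_; _⊆_; _∩_; _∪_; _─_; _-_; ⁅_⁆; ∣_∣)
open import Data.Fin.Subset.Properties using (_∈?_; drop-∷-⊆; p⊆q⇒∣p∣≤∣q∣; ∪-identityʳ; x∈p∩q⁺; x∈p∪q⁺; x∈p∪q⁻; x∈⁅x⁆; x∈⁅y⁆⇒x≡y)
open import Data.Fin.Patterns using (0F; 1F; 2F; 3F; 4F; 5F; 6F)
open import Data.Fin.Properties using (all?; any?; remQuot-combine; combine-remQuot)
open import Data.Vec using ([]; _∷_; here; lookup; tabulate)
open import Data.Vec.Properties using (tabulate∘lookup; tabulate-cong; lookup∘tabulate; lookup-zipWith; lookup-replicate; []=⇒lookup; lookup⇒[]=)
open import Data.Product using (Σ; _×_; _,_; ∃; uncurry)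
open import Data.Sum using (_⊎_; inj₁; inj₂)
open import Data.Empty using (⊥-elim)
open import Relation.Binary.PropositionalEquality using (_≡_; _≢_; refl; trans; cong; cong₂; subst; subst₂; module ≡-Reasoning) renaming (sym to ≡-sym)
open import Relation.Nullary using (yes; no; does; ¬?; _×-dec_)
open import Relation.Nullary.Decidable using (dec-true; dec-false; from-yes; _→-dec_)

subset-ext : ∀ {n} {p q : Subset n} → (∀ t → lookup p t ≡ lookup q t) → p ≡ q
subset-ext {p = p} {q} p≗q = begin
  p                   ≡⟨ ≡-sym (tabulate∘lookup p) ⟩
  tabulate (lookup p) ≡⟨ tabulate-cong p≗q ⟩
  tabulate (lookup q) ≡⟨ tabulate∘lookup q ⟩
  q                   ∎
  where open ≡-Reasoning

false≢true : false ≢ true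
false≢true ()

≟-sound : ∀ {n} {t s : Fin n} → does (t ≟ s) ≡ true → t ≡ s
≟-sound {t = t} {s} t≟s with t ≟ s
... | yes t≡s = t≡s

≟-sym : ∀ {n} (t s : Fin n) → does (t ≟ s) ≡ does (s ≟ t)
≟-sym t s with t ≟ s | s ≟ t
... | yes _    | yes _    = refl
... | no _     | no _     = refl
... | yes refl | no s≢t   = ⊥-elim (s≢t refl)
... | no t≢s   | yes refl = ⊥-elim (t≢s refl)

lookup-⁅⁆ : ∀ {n} (u t : Fin n) → lookup ⁅ u ⁆ t ≡ does (t ≟ u)
lookup-⁅⁆ zero    zero    = refl
lookup-⁅⁆ zero    (suc t) = lookup-replicate t false
lookup-⁅⁆ (suc u) zero    = refl
lookup-⁅⁆ (suc u) (suc t) = lookup-⁅⁆ u t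

lookup-─ : ∀ {n} (p q : Subset n) t → lookup (p ─ q) t ≡ lookup p t ∧ not (lookup q t)
lookup-─ (x ∷ p) (true  ∷ q) zero    = ≡-sym (∧-zeroʳ x)
lookup-─ (x ∷ p) (false ∷ q) zero    = ≡-sym (∧-identityʳ x)
lookup-─ (x ∷ p) (y     ∷ q) (suc t) = lookup-─ p q t

lookup-∪⁅⁆ : ∀ {n} (A : Subset n) x t → lookup (A ∪ ⁅ x ⁆) t ≡ lookup A t ∨ does (t ≟ x)
lookup-∪⁅⁆ A x t = trans (lookup-zipWith _∨_ t A ⁅ x ⁆) (cong (lookup A t ∨_) (lookup-⁅⁆ x t))

lookup-exchange : ∀ {n} (S : Subset n) u w t →
                  lookup ((S - u) ∪ ⁅ w ⁆) t ≡ (lookup S t ∧ not (does (t ≟ u))) ∨ does (t ≟ w)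
lookup-exchange S u w t = begin
  lookup ((S - u) ∪ ⁅ w ⁆) t              ≡⟨ lookup-∪⁅⁆ (S - u) w t ⟩
  lookup (S ─ ⁅ u ⁆) t ∨ does (t ≟ w)       ≡⟨ cong (_∨ does (t ≟ w)) (lookup-─ S ⁅ u ⁆ t) ⟩
  (lookup S t ∧ not (lookup ⁅ u ⁆ t)) ∨ _  ≡⟨ cong (λ b → (lookup S t ∧ not b) ∨ does (t ≟ w)) (lookup-⁅⁆ u t) ⟩
  (lookup S t ∧ not (does (t ≟ u))) ∨ _    ∎
  where open ≡-Reasoning

∣∪⁅⁆∣ : ∀ {n} (A : Subset n) x → lookup A x ≡ false → ∣ A ∪ ⁅ x ⁆ ∣ ≡ suc ∣ A ∣
∣∪⁅⁆∣ (false ∷ A) zero    _   = cong (λ B → suc ∣ B ∣) (∪-identityʳ A)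
∣∪⁅⁆∣ (true  ∷ A) (suc x) x∉A = cong suc (∣∪⁅⁆∣ A x x∉A)
∣∪⁅⁆∣ (false ∷ A) (suc x) x∉A = ∣∪⁅⁆∣ A x x∉A

⊆-large⇒≡ : ∀ {n} {p q : Subset n} → p ⊆ q → ∣ q ∣ ≤ ∣ p ∣ → p ≡ q
⊆-large⇒≡ {p = []}        {[]}        _   _     = refl
⊆-large⇒≡ {p = false ∷ p} {false ∷ q} p⊆q large = cong (false ∷_) (⊆-large⇒≡ (drop-∷-⊆ p⊆q) large)
⊆-large⇒≡ {p = true  ∷ p} {true  ∷ q} p⊆q large = cong (true ∷_) (⊆-large⇒≡ (drop-∷-⊆ p⊆q) (≤-pred large))
⊆-large⇒≡ {p = true  ∷ p} {false ∷ q} p⊆q _     with p⊆q here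
... | ()
⊆-large⇒≡ {p = false ∷ p} {true  ∷ q} p⊆q large =
  ⊥-elim (n≮n _ (≤-trans large (p⊆q⇒∣p∣≤∣q∣ (drop-∷-⊆ p⊆q))))

exchange-inserted : ∀ {n} (A : Subset n) x y → lookup A x ≡ false →
                    ((A ∪ ⁅ x ⁆) - x) ∪ ⁅ y ⁆ ≡ A ∪ ⁅ y ⁆
exchange-inserted A x y x∉A = subset-ext pointwise
  where
  pointwise : ∀ t → lookup (((A ∪ ⁅ x ⁆) - x) ∪ ⁅ y ⁆) t ≡ lookup (A ∪ ⁅ y ⁆) t
  pointwise t rewrite lookup-exchange (A ∪ ⁅ x ⁆) x y t | lookup-∪⁅⁆ A x t | lookup-∪⁅⁆ A y t
    with t ≟ x
  ... | yes refl rewrite x∉A = refl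
  ... | no _     = cong (_∨ does (t ≟ y)) (trans (∧-identityʳ _) (∨-identityʳ _))

edge⇒exchange : ∀ {n} (G : Graph n) (A : Subset n) {x y} → lookup A x ≡ false →
                Edge G x y → γIDAdj G (A ∪ ⁅ x ⁆) (A ∪ ⁅ y ⁆)
edge⇒exchange G A {x} {y} x∉A xy =
  x , y , x∈p∪q⁺ (inj₂ (x∈⁅x⁆ x)) , x∈p∪q⁺ (inj₂ (x∈⁅x⁆ y)) , xy , ≡-sym (exchange-inserted A x y x∉A)

-- Conversely, an exchange from A ∪ {x} to A ∪ {y} must remove x and insert
-- y, so it happens along the edge xy.
exchange⇒edge : ∀ {n} (G : Graph n) (A : Subset n) {x y} → lookup A x ≡ false → lookup A y ≡ false →
                γIDAdj G (A ∪ ⁅ x ⁆) (A ∪ ⁅ y ⁆) → Edge G x y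
exchange⇒edge G A {x} {y} x∉A y∉A (u , w , u∈S , _ , uw , T≡) = subst₂ (Edge G) u≡x w≡y uw
  where
  pointwise : ∀ t → lookup A t ∨ does (t ≟ y) ≡ ((lookup A t ∨ does (t ≟ x)) ∧ not (does (t ≟ u))) ∨ does (t ≟ w)
  pointwise t = begin
    lookup A t ∨ does (t ≟ y)                            ≡⟨ ≡-sym (lookup-∪⁅⁆ A y t) ⟩
    lookup (A ∪ ⁅ y ⁆) t                                 ≡⟨ cong (λ T → lookup T t) T≡ ⟩
    lookup ((A ∪ ⁅ x ⁆ - u) ∪ ⁅ w ⁆) t                   ≡⟨ lookup-exchange (A ∪ ⁅ x ⁆) u w t ⟩
    (lookup (A ∪ ⁅ x ⁆) t ∧ not (does (t ≟ u))) ∨ _      ≡⟨ cong (λ b → (b ∧ not (does (t ≟ u))) ∨ does (t ≟ w)) (lookup-∪⁅⁆ A x t) ⟩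
    ((lookup A t ∨ does (t ≟ x)) ∧ not (does (t ≟ u))) ∨ _ ∎
    where open ≡-Reasoning

  -- The removed vertex u is not in A ∪ {y}, since u ≠ w.
  u∉T : lookup A u ∨ does (u ≟ y) ≡ false
  u∉T rewrite pointwise u | dec-true (u ≟ u) refl | ∧-zeroʳ (lookup A u ∨ does (u ≟ x)) =
    dec-false (u ≟ w) λ { refl → false≢true (trans (≡-sym (irrefl G u)) uw) }

  -- u is in A ∪ {x} but not in A, so u = x.
  u≡x : u ≡ x
  u≡x = ≟-sound (trans (≡-sym u∈A∪x) ([]=⇒lookup u∈S))
    where
    u∈A∪x : lookup (A ∪ ⁅ x ⁆) u ≡ does (u ≟ x)
    u∈A∪x = trans (lookup-∪⁅⁆ A x u) (cong (_∨ does (u ≟ x)) (∨-conicalˡ _ _ u∉T))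

  -- y is in A ∪ {y} but not in A ∪ {x}, so it is the inserted vertex w.
  w≡y : w ≡ y
  w≡y = ≡-sym (≟-sound (≡-sym (subst₂ _≡_ y∈T y-inserted (pointwise y))))
    where
    y≢x : does (y ≟ x) ≡ false
    y≢x rewrite ≡-sym u≡x = trans (≟-sym y u) (∨-conicalʳ _ _ u∉T)
    y∈T : lookup A y ∨ does (y ≟ y) ≡ true
    y∈T rewrite y∉A | dec-true (y ≟ y) refl = refl
    y-inserted : ((lookup A y ∨ does (y ≟ x)) ∧ not (does (y ≟ u))) ∨ does (y ≟ w) ≡ does (y ≟ w)
    y-inserted rewrite y∉A | y≢x = refl

code-intro : ∀ {n} (G : Graph n) (T : Subset n) →
             (∀ v → ∃ λ t → t ∈ T × lookup (N[ G ] v) t ≡ true) →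
             (∀ u v → u ≢ v → ∃ λ t → t ∈ T × lookup (N[ G ] u) t ≢ lookup (N[ G ] v) t) →
             IsIDCode G T
code-intro G T dominated separated = nonempty , distinct
  where
  nonempty : ∀ v → Nonempty (N[ G ] v ∩ T)
  nonempty v with dominated v
  ... | t , t∈T , t∈Nv = t , x∈p∩q⁺ (lookup⇒[]= t (N[ G ] v) t∈Nv , t∈T)

  distinct : ∀ u v → u ≢ v → N[ G ] u ∩ T ≢ N[ G ] v ∩ T
  distinct u v u≢v traces≡ with separated u v u≢v
  ... | t , t∈T , differ = differ (begin
    lookup (N[ G ] u) t                    ≡⟨ ≡-sym (∧-identityʳ _) ⟩
    lookup (N[ G ] u) t ∧ true             ≡⟨ cong (lookup (N[ G ] u) t ∧_) (≡-sym ([]=⇒lookup t∈T)) ⟩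
    lookup (N[ G ] u) t ∧ lookup T t       ≡⟨ ≡-sym (lookup-zipWith _∧_ t (N[ G ] u) T) ⟩
    lookup (N[ G ] u ∩ T) t                ≡⟨ cong (λ X → lookup X t) traces≡ ⟩
    lookup (N[ G ] v ∩ T) t                ≡⟨ lookup-zipWith _∧_ t (N[ G ] v) T ⟩
    lookup (N[ G ] v) t ∧ lookup T t       ≡⟨ cong (lookup (N[ G ] v) t ∧_) ([]=⇒lookup t∈T) ⟩
    lookup (N[ G ] v) t ∧ true             ≡⟨ ∧-identityʳ _ ⟩
    lookup (N[ G ] v) t                    ∎)
    where open ≡-Reasoning

code-separates : ∀ {n} (G : Graph n) {T : Subset n} → IsIDCode G T → ∀ {u v} → u ≢ v →
                 ∃ λ t → t ∈ T × lookup (N[ G ] u) t ≢ lookup (N[ G ] v) t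
code-separates G {T} (_ , distinct) {u} {v} u≢v
  with any? (λ t → t ∈? T ×-dec ¬? (lookup (N[ G ] u) t Bool.≟ lookup (N[ G ] v) t))
... | yes separator = separator
... | no  none      = ⊥-elim (distinct u v u≢v (subset-ext agree))
  where
  agree : ∀ t → lookup (N[ G ] u ∩ T) t ≡ lookup (N[ G ] v ∩ T) t
  agree t rewrite lookup-zipWith _∧_ t (N[ G ] u) T | lookup-zipWith _∧_ t (N[ G ] v) T
    with lookup T t in t∈T
  ... | false = trans (∧-zeroʳ _) (≡-sym (∧-zeroʳ _))
  ... | true  with lookup (N[ G ] u) t Bool.≟ lookup (N[ G ] v) t
  ...   | yes same   = cong (_∧ true) same
  ...   | no  differ = ⊥-elim (none (t , lookup⇒[]= t T t∈T , differ))

forced-member : ∀ {n} (G : Graph n) {T : Subset n} → IsIDCode G T → ∀ {p q f} → p ≢ q →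
                (∀ t → t ≢ f → lookup (N[ G ] p) t ≡ lookup (N[ G ] q) t) → f ∈ T
forced-member G isCode {f = f} p≢q twins with code-separates G isCode p≢q
... | t , t∈T , differ with t ≟ f
...   | yes refl = t∈T
...   | no  t≢f  = ⊥-elim (differ (twins t t≢f))

module _ {n k} (G : Graph n) (S : Fin k → Subset n) (s : ℕ)
         (codes : ∀ j → IsIDCode G (S j)) (size : ∀ j → ∣ S j ∣ ≡ s)
         (covered : ∀ T → IsIDCode G T → ∃ λ j → S j ⊆ T) where

  cover-γID-sets : ∀ i → IsγIDSet G (S i)
  cover-γID-sets i = codes i , minimum
    where
    minimum : ∀ T → IsIDCode G T → ∣ S i ∣ ≤ ∣ T ∣
    minimum T isCode with covered T isCode
    ... | j , Sj⊆T = subst (_≤ ∣ T ∣) (trans (size j) (≡-sym (size i))) (p⊆q⇒∣p∣≤∣q∣ Sj⊆T)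

  cover-exhausts : ∀ T → IsγIDSet G T → ∃ λ i → S i ≡ T
  cover-exhausts T (isCode , minimum) with covered T isCode
  ... | j , Sj⊆T = j , ⊆-large⇒≡ Sj⊆T (minimum (S j) (codes j))

gadgetAdj : Fin 7 → Fin 7 → Bool
gadgetAdj 0F 0F = false
gadgetAdj 0F _  = true
gadgetAdj _  0F = true
gadgetAdj 1F 3F = true
gadgetAdj 1F 4F = true
gadgetAdj 3F 1F = true
gadgetAdj 4F 1F = true
gadgetAdj 2F 5F = true
gadgetAdj 2F 6F = true
gadgetAdj 5F 2F = true
gadgetAdj 6F 2F = true
gadgetAdj _  _  = false

gadget : Graph 7
gadget = record
  { adj    = gadgetAdj
  ; sym    = from-yes (all? λ i → all? λ j → gadgetAdj i j Bool.≟ gadgetAdj j i)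
  ; irrefl = from-yes (all? λ i → gadgetAdj i i Bool.≟ false)
  }

isApex : Fin 7 → Bool
isApex 0F = true
isApex _  = false

isLeaf : Fin 7 → Bool
isLeaf 3F = true
isLeaf 4F = true
isLeaf 5F = true
isLeaf 6F = true
isLeaf _  = false

gadgetNb : Fin 7 → Fin 7 → Bool
gadgetNb l l′ = does (l′ ≟ l) ∨ gadgetAdj l l′

LeafTwins : Fin 7 → Fin 7 → Fin 7 → Set
LeafTwins f p q = p ≢ q × isApex p ≡ false × isApex q ≡ false × (∀ l → l ≢ f → gadgetNb p l ≡ gadgetNb q l)

leaf-twins : ∀ f → isLeaf f ≡ true → ∃ λ p → ∃ λ q → LeafTwins f p q
leaf-twins = from-yes (all? λ f → (isLeaf f Bool.≟ true) →-dec
  any? λ p → any? λ q → ¬? (p ≟ q) ×-dec (isApex p Bool.≟ false) ×-dec (isApex q Bool.≟ false) ×-dec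
    all? λ l → ¬? (l ≟ f) →-dec (gadgetNb p l Bool.≟ gadgetNb q l))

leaves-separate : ∀ l l′ → l ≢ l′ → ∃ λ f → isLeaf f ≡ true × gadgetNb l f ≢ gadgetNb l′ f
leaves-separate = from-yes (all? λ l → all? λ l′ → ¬? (l ≟ l′) →-dec
  any? λ f → (isLeaf f Bool.≟ true) ×-dec ¬? (gadgetNb l f Bool.≟ gadgetNb l′ f))

leaves-dominate : ∀ l → ∃ λ f → isLeaf f ≡ true × gadgetNb l f ≡ true
leaves-dominate = from-yes (all? λ l → any? λ f → (isLeaf f Bool.≟ true) ×-dec (gadgetNb l f Bool.≟ true))

leaf-missed : ∀ l → isApex l ≡ false → ∃ λ f → isLeaf f ≡ true × gadgetNb l f ≡ false
leaf-missed = from-yes (all? λ l → (isApex l Bool.≟ false) →-dec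
  any? λ f → (isLeaf f Bool.≟ true) ×-dec (gadgetNb l f Bool.≟ false))

leaf-not-apex : ∀ f → isLeaf f ≡ true → isApex f ≡ false
leaf-not-apex = from-yes (all? λ f → (isLeaf f Bool.≟ true) →-dec (isApex f Bool.≟ false))

apex-universal : ∀ l → gadgetNb 0F l ≡ true
apex-universal = from-yes (all? λ l → gadgetNb 0F l Bool.≟ true)

cone : ∀ {k} → Graph k → Graph (suc k)
cone H = record { adj = coneAdj ; sym = coneAdj-sym ; irrefl = coneAdj-irrefl }
  where
  coneAdj : Fin (suc _) → Fin (suc _) → Bool
  coneAdj zero    zero    = false
  coneAdj zero    (suc _) = true
  coneAdj (suc _) zero    = true
  coneAdj (suc i) (suc j) = adj H i j

  coneAdj-sym : ∀ i j → coneAdj i j ≡ coneAdj j i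
  coneAdj-sym zero    zero    = refl
  coneAdj-sym zero    (suc _) = refl
  coneAdj-sym (suc _) zero    = refl
  coneAdj-sym (suc i) (suc j) = sym H i j

  coneAdj-irrefl : ∀ i → coneAdj i i ≡ false
  coneAdj-irrefl zero    = refl
  coneAdj-irrefl (suc i) = irrefl H i

module Construction {k : ℕ} (H : Graph k) where

  data V : Set where
    at : Fin (suc k) → Fin 7 → V
    w  : V

  isBase : Fin (suc k) → Bool
  isBase zero    = true
  isBase (suc _) = false

  adjV : V → V → Bool
  adjV (at c l) (at c′ l′) = if does (c ≟ c′) then gadgetAdj l l′ else isApex l ∧ isApex l′ ∧ adj (cone H) c c′
  adjV (at c _) w          = isBase c
  adjV w        (at c _)   = isBase c
  adjV w        w          = false

  nbV : V → V → Bool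
  nbV (at c l) (at c′ l′) = if does (c ≟ c′) then gadgetNb l l′ else isApex l ∧ isApex l′ ∧ adj (cone H) c c′
  nbV (at c _) w          = isBase c
  nbV w        (at c _)   = isBase c
  nbV w        w          = true

  adjV-sym : ∀ a b → adjV a b ≡ adjV b a
  adjV-sym (at c l) (at c′ l′) rewrite ≟-sym c c′ with c′ ≟ c
  ... | yes refl = sym gadget l l′
  ... | no  _    = begin
    isApex l ∧ isApex l′ ∧ adj (cone H) c c′    ≡⟨ Bool.∧-assoc (isApex l) _ _ ⟨
    (isApex l ∧ isApex l′) ∧ adj (cone H) c c′  ≡⟨ cong₂ _∧_ (Bool.∧-comm (isApex l) _) (sym (cone H) c c′) ⟩
    (isApex l′ ∧ isApex l) ∧ adj (cone H) c′ c  ≡⟨ Bool.∧-assoc (isApex l′) _ _ ⟩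
    isApex l′ ∧ isApex l ∧ adj (cone H) c′ c    ∎
    where open ≡-Reasoning
  adjV-sym (at _ _) w        = refl
  adjV-sym w        (at _ _) = refl
  adjV-sym w        w        = refl

  adjV-irrefl : ∀ a → adjV a a ≡ false
  adjV-irrefl (at c l) rewrite dec-true (c ≟ c) refl = irrefl gadget l
  adjV-irrefl w        = refl

  nbV-refl : ∀ a → nbV a a ≡ true
  nbV-refl (at c l) rewrite dec-true (c ≟ c) refl | dec-true (l ≟ l) refl = refl
  nbV-refl w        = refl

  adjV⇒nbV : ∀ {a b} → a ≢ b → adjV a b ≡ nbV a b
  adjV⇒nbV {at c l} {at c′ l′} a≢b with c ≟ c′
  ... | yes refl = cong (_∨ gadgetAdj l l′) (≡-sym (dec-false (l′ ≟ l) λ { refl → a≢b refl }))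
  ... | no  _    = refl
  adjV⇒nbV {at _ _} {w}      _   = refl
  adjV⇒nbV {w}      {at _ _} _   = refl
  adjV⇒nbV {w}      {w}      w≢w = ⊥-elim (w≢w refl)

  nb-same-copy : ∀ c l l′ → nbV (at c l) (at c l′) ≡ gadgetNb l l′
  nb-same-copy c l l′ rewrite dec-true (c ≟ c) refl = refl

  nb-other-copy : ∀ {c c′} → c′ ≢ c → ∀ l′ {f} → isApex f ≡ false → nbV (at c′ l′) (at c f) ≡ false
  nb-other-copy {c} {c′} c′≢c l′ f° rewrite dec-false (c′ ≟ c) c′≢c | f° = ∧-zeroʳ (isApex l′)

  isLeafV : V → Bool
  isLeafV (at _ l) = isLeaf l
  isLeafV w        = false

  InCode : Fin k → V → Set
  InCode i b = isLeafV b ≡ true ⊎ b ≡ at (suc i) 0F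

  leaf-neighbour : ∀ a → ∃ λ b → isLeafV b ≡ true × nbV a b ≡ true
  leaf-neighbour (at c l) with leaves-dominate l
  ... | f , leaf , seen = at c f , leaf , trans (nb-same-copy c l f) seen
  leaf-neighbour w = at zero 3F , refl , refl

  -- w is separated from every other vertex by a member of S i: by a leaf,
  -- except for the apex of copy 0, which is separated by x i.
  separate-from-w : ∀ i c l → ∃ λ b → InCode i b × nbV (at c l) b ≢ nbV w b
  separate-from-w i zero 0F = at (suc i) 0F , inj₂ refl , λ ()
  separate-from-w i zero (suc l) with leaf-missed (suc l) refl
  ... | f , leaf , missed = at zero f , inj₁ leaf , λ seen → false≢true (trans (≡-sym missed) seen)
  separate-from-w i (suc j) l with leaves-dominate l
  ... | f , leaf , seen = at (suc j) f , inj₁ leaf , λ same →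
    false≢true (trans (≡-sym same) (trans (nb-same-copy (suc j) l f) seen))

  separate : ∀ i a b → a ≢ b → ∃ λ c → InCode i c × nbV a c ≢ nbV b c
  separate i (at c l) (at c′ l′) a≢b with c ≟ c′
  ... | yes refl with leaves-separate l l′ (λ { refl → a≢b refl })
  ...   | f , leaf , differ = at c f , inj₁ leaf ,
          subst₂ _≢_ (≡-sym (nb-same-copy c l f)) (≡-sym (nb-same-copy c l′ f)) differ
  separate i (at c l) (at c′ l′) a≢b | no c≢c′ with leaves-dominate l
  ...   | f , leaf , seen = at c f , inj₁ leaf , λ same → false≢true (begin
          false                ≡⟨ nb-other-copy (λ c′≡c → c≢c′ (≡-sym c′≡c)) l′ (leaf-not-apex f leaf) ⟨
          nbV (at c′ l′) (at c f) ≡⟨ same ⟨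
          nbV (at c l) (at c f)   ≡⟨ nb-same-copy c l f ⟩
          gadgetNb l f            ≡⟨ seen ⟩
          true                    ∎)
    where open ≡-Reasoning
  separate i (at c l) w        _   = separate-from-w i c l
  separate i w        (at c l) _   with separate-from-w i c l
  ... | b , member , differ = b , member , λ same → differ (≡-sym same)
  separate i w        w        w≢w = ⊥-elim (w≢w refl)

  copy-twins : ∀ c {f p q} → LeafTwins f p q → ∀ b → b ≢ at c f → nbV (at c p) b ≡ nbV (at c q) b
  copy-twins c (_ , p° , q° , twins) (at c′ l) b≢ with c ≟ c′
  ... | yes refl = twins l (λ { refl → b≢ refl })
  ... | no  _    rewrite p° | q° = refl
  copy-twins c _ w _ = refl

  apex-separators : ∀ b → nbV (at zero 0F) b ≢ nbV w b → ∃ λ j → b ≡ at (suc j) 0F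
  apex-separators (at zero    l)       differ = ⊥-elim (differ (apex-universal l))
  apex-separators (at (suc j) 0F)      _      = j , refl
  apex-separators (at (suc j) (suc l)) differ = ⊥-elim (differ refl)
  apex-separators w                    differ = ⊥-elim (differ refl)

  m : ℕ
  m = suc (suc k * 7)

  enc : V → Fin m
  enc (at c l) = suc (combine c l)
  enc w        = zero

  vertex : Fin m → V
  vertex zero    = w
  vertex (suc t) = uncurry at (remQuot 7 t)

  vertex-enc : ∀ a → vertex (enc a) ≡ a
  vertex-enc (at c l) = cong (uncurry at) (remQuot-combine c l)
  vertex-enc w        = refl

  enc-vertex : ∀ t → enc (vertex t) ≡ t
  enc-vertex zero    = refl
  enc-vertex (suc t) = cong suc (combine-remQuot {suc k} 7 t)

  vertex-injective : ∀ {s t} → vertex s ≡ vertex t → s ≡ t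
  vertex-injective {s} {t} eq = trans (≡-sym (enc-vertex s)) (trans (cong enc eq) (enc-vertex t))

  enc-injective : ∀ {a b} → enc a ≡ enc b → a ≡ b
  enc-injective {a} {b} eq = trans (≡-sym (vertex-enc a)) (trans (cong vertex eq) (vertex-enc b))

  G : Graph m
  G = record
    { adj    = λ s t → adjV (vertex s) (vertex t)
    ; sym    = λ s t → adjV-sym (vertex s) (vertex t)
    ; irrefl = λ t → adjV-irrefl (vertex t)
    }

  N-lookup : ∀ s t → lookup (N[ G ] s) t ≡ nbV (vertex s) (vertex t)
  N-lookup s t = trans (lookup∘tabulate (λ u → does (u ≟ s) ∨ adj G s u) t) (closed (t ≟ s))
    where
    closed : ∀ d → does d ∨ adjV (vertex s) (vertex t) ≡ nbV (vertex s) (vertex t)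
    closed (yes refl) = ≡-sym (nbV-refl (vertex t))
    closed (no  t≢s)  = adjV⇒nbV λ same → t≢s (vertex-injective (≡-sym same))

  N-enc : ∀ a t → lookup (N[ G ] (enc a)) t ≡ nbV a (vertex t)
  N-enc a t = trans (N-lookup (enc a) t) (cong (λ b → nbV b (vertex t)) (vertex-enc a))

  N-at : ∀ s b → lookup (N[ G ] s) (enc b) ≡ nbV (vertex s) b
  N-at s b = trans (N-lookup s (enc b)) (cong (nbV (vertex s)) (vertex-enc b))

  -- The set L of all leaves, the apices x i and the codes S i = L ∪ {x i}.
  -- L is opaque: it is only used through its membership test lookup-Leaves.
  opaque
    Leaves : Subset m
    Leaves = tabulate (λ t → isLeafV (vertex t))

    lookup-Leaves : ∀ t → lookup Leaves t ≡ isLeafV (vertex t)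
    lookup-Leaves = lookup∘tabulate (λ t → isLeafV (vertex t))

  apex : Fin k → Fin m
  apex i = enc (at (suc i) 0F)

  code : Fin k → Subset m
  code i = Leaves ∪ ⁅ apex i ⁆

  lookup-Leaves-enc : ∀ b → lookup Leaves (enc b) ≡ isLeafV b
  lookup-Leaves-enc b = trans (lookup-Leaves (enc b)) (cong isLeafV (vertex-enc b))

  apex∉Leaves : ∀ i → lookup Leaves (apex i) ≡ false
  apex∉Leaves i = lookup-Leaves-enc (at (suc i) 0F)

  in-code : ∀ i {b} → InCode i b → enc b ∈ code i
  in-code i {b} (inj₁ leaf) = x∈p∪q⁺ {q = ⁅ apex i ⁆} (inj₁ (lookup⇒[]= (enc b) Leaves (trans (lookup-Leaves-enc b) leaf)))
  in-code i     (inj₂ refl) = x∈p∪q⁺ {p = Leaves} (inj₂ (x∈⁅x⁆ (apex i)))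

  code-is-ID : ∀ i → IsIDCode G (code i)
  code-is-ID i = code-intro G (code i) dominated separated
    where
    dominated : ∀ s → ∃ λ t → t ∈ code i × lookup (N[ G ] s) t ≡ true
    dominated s with leaf-neighbour (vertex s)
    ... | b , leaf , seen = enc b , in-code i (inj₁ leaf) , trans (N-at s b) seen

    separated : ∀ s s′ → s ≢ s′ → ∃ λ t → t ∈ code i × lookup (N[ G ] s) t ≢ lookup (N[ G ] s′) t
    separated s s′ s≢s′ with separate i (vertex s) (vertex s′) (λ eq → s≢s′ (vertex-injective eq))
    ... | b , member , differ = enc b , in-code i member ,
          λ same → differ (trans (≡-sym (N-at s b)) (trans same (N-at s′ b)))

  leaf-forced : ∀ {T} → IsIDCode G T → ∀ c {f} → isLeaf f ≡ true → enc (at c f) ∈ T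
  leaf-forced {T} isCode c {f} leaf = forced-by (leaf-twins f leaf)
    where
    forced-by : (∃ λ p → ∃ λ q → LeafTwins f p q) → enc (at c f) ∈ T
    forced-by (p , q , twins@(p≢q , _)) = forced-member G isCode {enc (at c p)} {enc (at c q)} p′≢q′ twins′
      where
      p′≢q′ : enc (at c p) ≢ enc (at c q)
      p′≢q′ eq with enc-injective {at c p} {at c q} eq
      ... | refl = p≢q refl

      twins′ : ∀ s → s ≢ enc (at c f) → lookup (N[ G ] (enc (at c p))) s ≡ lookup (N[ G ] (enc (at c q))) s
      twins′ s s≢ = begin
        lookup (N[ G ] (enc (at c p))) s ≡⟨ N-enc (at c p) s ⟩
        nbV (at c p) (vertex s)          ≡⟨ copy-twins c twins (vertex s) (λ eq → s≢ (trans (≡-sym (enc-vertex s)) (cong enc eq))) ⟩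
        nbV (at c q) (vertex s)          ≡⟨ N-enc (at c q) s ⟨
        lookup (N[ G ] (enc (at c q))) s ∎
        where open ≡-Reasoning

  apex-forced : ∀ {T} → IsIDCode G T → ∃ λ j → apex j ∈ T
  apex-forced {T} isCode with code-separates G isCode {enc (at zero 0F)} {enc w} (λ ())
  ... | t , t∈T , differ with apex-separators (vertex t) (λ same → differ (trans (N-enc (at zero 0F) t) (trans same (≡-sym (N-enc w t)))))
  ... | j , t≡ = j , subst (_∈ T) (trans (≡-sym (enc-vertex t)) (cong enc t≡)) t∈T

  code-covered : ∀ T → IsIDCode G T → ∃ λ j → code j ⊆ T
  code-covered T isCode = covered-by (apex-forced isCode)
    where
    leaf-member : ∀ a → isLeafV a ≡ true → enc a ∈ T
    leaf-member (at c f) leaf = leaf-forced isCode c leaf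

    covered-by : (∃ λ j → apex j ∈ T) → ∃ λ j → code j ⊆ T
    covered-by (j , xj∈T) = j , λ {t} t∈Sj → contained t (x∈p∪q⁻ Leaves ⁅ apex j ⁆ t∈Sj)
      where
      contained : ∀ t → t ∈ Leaves ⊎ t ∈ ⁅ apex j ⁆ → t ∈ T
      contained t (inj₁ t∈L)  = subst (_∈ T) (enc-vertex t)
                                  (leaf-member (vertex t) (trans (≡-sym (lookup-Leaves t)) ([]=⇒lookup t∈L)))
      contained t (inj₂ t∈xj) = subst (_∈ T) (≡-sym (x∈⁅y⁆⇒x≡y (apex j) t∈xj)) xj∈T

  code-size : ∀ i → ∣ code i ∣ ≡ suc ∣ Leaves ∣
  code-size i = ∣∪⁅⁆∣ Leaves (apex i) (apex∉Leaves i)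

  apex-injective : ∀ {i j} → apex i ≡ apex j → i ≡ j
  apex-injective {i} {j} xi≡xj with enc-injective {at (suc i) 0F} {at (suc j) 0F} xi≡xj
  ... | refl = refl

  -- S i determines i, because x i ∈ S j only for j = i.
  code-injective : ∀ i j → code i ≡ code j → i ≡ j
  code-injective i j Si≡Sj with x∈p∪q⁻ Leaves ⁅ apex j ⁆ (subst (apex i ∈_) Si≡Sj (in-code i (inj₂ refl)))
  ... | inj₁ xi∈L  = ⊥-elim (false≢true (trans (≡-sym (apex∉Leaves i)) ([]=⇒lookup xi∈L)))
  ... | inj₂ xi∈xj = apex-injective (x∈⁅y⁆⇒x≡y (apex j) xi∈xj)

  apex-adj : ∀ i j → adj G (apex i) (apex j) ≡ adj H i j
  apex-adj i j = trans (cong₂ adjV (vertex-enc (at (suc i) 0F)) (vertex-enc (at (suc j) 0F))) (apices (i ≟ j))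
    where
    apices : ∀ d → (if does d then false else adj H i j) ≡ adj H i j
    apices (yes refl) = ≡-sym (irrefl H i)
    apices (no  _)    = refl

  code-adjacency : ∀ i j → (Edge H i j → γIDAdj G (code i) (code j)) × (γIDAdj G (code i) (code j) → Edge H i j)
  code-adjacency i j =
    (λ ij → edge⇒exchange G Leaves {apex i} {apex j} (apex∉Leaves i) (trans (apex-adj i j) ij)) ,
    (λ Si~Sj → trans (≡-sym (apex-adj i j)) (exchange⇒edge G Leaves {apex i} {apex j} (apex∉Leaves i) (apex∉Leaves j) Si~Sj))

theorem5 : (k : ℕ) (H : Graph k) → Σ ℕ λ m → Σ (Graph m) λ G → γIDGraph≅ G H
theorem5 k H =
  m , G , code , code-injective ,
  cover-γID-sets G code (suc ∣ Leaves ∣) code-is-ID code-size code-covered ,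
  cover-exhausts G code (suc ∣ Leaves ∣) code-is-ID code-size code-covered ,
  code-adjacency
  where open Construction H
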